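{- Let $\varepsilon\in(0,1)$, let $n_0\ge\max(900,8\ln(1/\varepsilon))$ be an integer and $n_1:=2n_0$. Then for every strategy of Alice and every cycle $\beta$ on $[n_0]$ such that, on the event $B_{n_0}=\beta$, $S_{n_0}\le\ln^2 n_0$, the following holds: conditioned on $B_{n_0}=\beta$, the probability that among Alice's moves at times $n=n_0+1,\dots,n_1$ there are fewer than $n_0/3$ d-moves is at most $\varepsilon$.
   Context: For $m\ge 3$, a cycle on $[m]=\{1,\dots,m\}$ is an undirected Hamiltonian cycle with node set $[m]$; its edges are cycle-edges. An evolving cycle is a sequence $(A_m)_{m\ge3}$ where $A_3$ is the unique cycle on $\{1,2,3\}$ and $A_m$ ($m\ge4$) is obtained from $A_{m-1}$ by inserting node $m$ into one cycle-edge of $A_{m-1}$. Game: Bob's evolving cycle $B$ is random: for each $m\ge4$, node $m$ is inserted into a cycle-edge of $B_{m-1}$ chosen uniformly at random, independently of everything else. Alice's evolving cycle $A$ is produced by a strategy: for every $m\ge4$, the cycle-edge of $A_{m-1}$ into which node $m$ is inserted is a deterministic function of $B_{m-1}$. Alice's move at time $m$ is a c-move if the chosen cycle-edge of $A_{m-1}$ belongs to $E(A_{m-1})\cap E(B_{m-1})$ (the set of cycle-edges common to both cycles), and a d-move otherwise. $S_m:=|E(A_m)\cap E(B_m)|$; it is determined by $B_m$. -}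

module Defs where

open import Data.Nat using (ℕ; zero; suc; _+_; _*_; _∸_; _^_; _≤_; _<_; _≤ᵇ_; _<ᵇ_; _≡ᵇ_)
open import Data.Nat using (_!)
open import Data.Bool using (Bool; true; false; if_then_else_; _∧_; _∨_)
open import Data.List using (List; []; _∷_; length; map; concatMap; upTo; filterᵇ)
open import Data.Bool.ListAction using (any)
open import Data.Product using (_×_; _,_; proj₁; proj₂)

-- A cycle on [m] reachable as an evolving cycle is represented by the
-- list of its nodes in cyclic order, starting with node 1 (insertions
-- never move node 1 from the front, and 2 always precedes 3, which fixes
-- the orientation, so this representation is canonical).
-- Cycle-edge number k of a list x₀ … x_{m-1} is {x_k , x_{k+1 mod m}};
-- indices k ≥ m-1 denote the last edge {x_{m-1}, x₀}.

-- insert node v into cycle-edge number k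
insertAfter : ℕ → ℕ → List ℕ → List ℕ
insertAfter k       v []       = v ∷ []
insertAfter zero    v (x ∷ xs) = x ∷ v ∷ xs
insertAfter (suc k) v (x ∷ xs) = x ∷ insertAfter k v xs

cycle3 : List ℕ
cycle3 = 1 ∷ 2 ∷ 3 ∷ []

-- Reach m xs : xs is (the representation of) a cycle on [m] obtainable
-- as the m-th term of an evolving cycle (= every cycle on [m]).
data IsCycle : ℕ → List ℕ → Set where
  base : IsCycle 3 cycle3
  step : ∀ {m xs k} → IsCycle m xs → k < m → IsCycle (suc m) (insertAfter k (suc m) xs)

edges : List ℕ → List (ℕ × ℕ)
edges []       = []
edges (x ∷ xs) = go (x ∷ xs)
  where
  go : List ℕ → List (ℕ × ℕ)
  go []           = []
  go (y ∷ [])     = (y , x) ∷ []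
  go (y ∷ z ∷ r)  = (y , z) ∷ go (z ∷ r)

edgeAt : ℕ → List (ℕ × ℕ) → ℕ × ℕ
edgeAt k       []           = (0 , 0)
edgeAt k       (e ∷ [])     = e
edgeAt zero    (e ∷ _ ∷ _)  = e
edgeAt (suc k) (_ ∷ e ∷ es) = edgeAt k (e ∷ es)

sameEdge : ℕ × ℕ → ℕ × ℕ → Bool
sameEdge (u , v) (u' , v') = ((u ≡ᵇ u') ∧ (v ≡ᵇ v')) ∨ ((u ≡ᵇ v') ∧ (v ≡ᵇ u'))

isEdge : ℕ × ℕ → List ℕ → Bool
isEdge e xs = any (sameEdge e) (edges xs)

commonEdges : List ℕ → List ℕ → ℕ
commonEdges a b = length (filterᵇ (λ e → isEdge e b) (edges a))

-- Strategies: at time m, Alice inserts node m into cycle-edge number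
-- (s B_{m-1}) of A_{m-1} (numbering as above; every cycle-edge is
-- reachable, so this is exactly a deterministic function of B_{m-1}
-- to the cycle-edges of A_{m-1}).
Strategy : Set
Strategy = List ℕ → ℕ

aliceStep : Strategy → List ℕ → List ℕ → List ℕ
aliceStep s b a = insertAfter (s b) (suc (length b)) a

isDMove : Strategy → List ℕ → List ℕ → Bool
isDMove s b a = if isEdge (edgeAt (s b) (edges a)) b then false else true

-- B_m recovered from B_n (n ≥ m): delete the nodes > m
restrict : ℕ → List ℕ → List ℕ
restrict m = filterᵇ (λ x → x ≤ᵇ m)

-- Alice's cycle A_{3+d}, when Bob's cycle at some time n ≥ 3+d is β
aliceCycle : Strategy → List ℕ → ℕ → List ℕ
aliceCycle s β zero    = cycle3
aliceCycle s β (suc d) = aliceStep s (restrict (3 + d) β) (aliceCycle s β d)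

aliceAt : Strategy → ℕ → List ℕ → List ℕ
aliceAt s n₀ β = aliceCycle s β (n₀ ∸ 3)

-- Bob's future choices: sequences (c₁,…,c_d) with cᵢ < b₀ + i - 1 (i ≥ 1),
-- i.e. cᵢ is a cycle-edge index of B_{m-1} at time m = b₀ + i.
choiceSeqs : ℕ → ℕ → List (List ℕ)
choiceSeqs b₀ zero    = [] ∷ []
choiceSeqs b₀ (suc d) = concatMap (λ c → map (c ∷_) (choiceSeqs (suc b₀) d)) (upTo b₀)

dMoves : Strategy → List ℕ → List ℕ → List ℕ → ℕ
dMoves s b a []       = 0
dMoves s b a (c ∷ cs) =
  (if isDMove s b a then 1 else 0)
  + dMoves s (insertAfter c (suc (length b)) b) (aliceStep s b a) cs

-- number of Bob futures (times n₀+1 … 2n₀, all equally likely) in which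
-- Alice makes fewer than n₀/3 d-moves
badCount : Strategy → ℕ → List ℕ → ℕ
badCount s n₀ β =
  length (filterᵇ (λ cs → 3 * dMoves s β (aliceAt s n₀ β) cs <ᵇ n₀) (choiceSeqs n₀ n₀))

totalCount : ℕ → ℕ
totalCount n₀ = length (choiceSeqs n₀ n₀)

-- expPartial x k = k! · Σ_{j ≤ k} x^j / j!
expPartial : ℕ → ℕ → ℕ
expPartial x zero    = 1
expPartial x (suc k) = suc k * expPartial x k + x ^ suc k

-- (√S)^j = p + q √S, returned as (p , q)
sqrtPow : ℕ → ℕ → ℕ × ℕ
sqrtPow S zero    = (1 , 0)
sqrtPow S (suc j) = (S * proj₂ (sqrtPow S j) , proj₁ (sqrtPow S j))

-- m! · Σ_{j ≤ m} (√S)^j / j! = P + Q √S, returned as (P , Q)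
sqrtExpPartial : ℕ → ℕ → ℕ × ℕ
sqrtExpPartial S zero    = (1 , 0)
sqrtExpPartial S (suc m) =
  ( suc m * proj₁ (sqrtExpPartial S m) + proj₁ (sqrtPow S (suc m))
  , suc m * proj₂ (sqrtExpPartial S m) + proj₂ (sqrtPow S (suc m)) )

-- S ≤ ln² n  ⟺  e^{√S} ≤ n  ⟺  ∀ m, m!·Σ_{j≤m} (√S)^j/j! ≤ n·m!
LnSqBound : ℕ → ℕ → Set
LnSqBound S n = ∀ m →
  let P = proj₁ (sqrtExpPartial S m)
      Q = proj₂ (sqrtExpPartial S m)
  in (P ≤ n * m !) × (S * (Q * Q) ≤ (n * m ! ∸ P) * (n * m ! ∸ P))

-- Let S be the number of common cycle-edges. In one round Alice inserts the new
-- node m into an edge e of A and Bob into an edge f of B. A c-move subdivides, and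
-- so loses, the common edge e, and the two new edges at m can only be common if e
-- and f share an endpoint (a "touching" move); hence S' + [c-move] ≤ S + 2 [touching].
-- Summed over the n₀ rounds, n₀ ≤ #d-moves + S_{n₀} + 2 #touching, so fewer than
-- n₀/3 d-moves together with S_{n₀} ≤ ln² n₀ ≤ n₀/9 force at least K = ⌊n₀/4⌋ + 1
-- touching moves. Only 4 of Bob's ≥ n₀ edges touch a given e, which bounds the
-- probability of that by (4n₀)^K / (n₀^K K!) = 4^K / K!. Finally m^m ≤ 4^m m!
-- gives (4^K / K!)^8 e^{n₀} ≤ 1, while the hypothesis on ε = a/b says that
-- ε^{-8} is at most a partial sum of the series of e^{n₀}.

module Submission where

open import Defs
open import Data.Nat using (ℕ; _*_; _^_; _≤_; _<_)
open import Data.Nat using (_!)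
open import Data.List using (List)
open import Data.Product using (∃)

import Algebra.Properties.CommutativeSemigroup as CommutativeSemigroupProperties
open import Data.Bool using (Bool; true; false; if_then_else_; _∨_; T)
open import Data.Bool.Properties using (T-∨; T-∧)
open import Data.Bool.ListAction using (any)
open import Data.Empty using (⊥-elim)
open import Data.List using ([]; _∷_; _++_; length; map; filterᵇ; concatMap; drop; upTo; applyUpTo)
open import Data.List.Properties using (length-++; filter-++; length-filter; filter-none; map-cong; map-upTo; length-upTo; length-map)
open import Data.List.Membership.Propositional using (_∈_; find; lose)
open import Data.List.Relation.Unary.Any using (here; there)
open import Data.List.Relation.Unary.Any.Properties using (any⁺; any⁻)
open import Data.List.Relation.Unary.All as All using (All; []; _∷_; universal)
open import Data.List.Relation.Unary.All.Properties using (concat⁺; map⁺)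
open import Data.Nat using (zero; suc; _+_; _∸_; _≡ᵇ_; _≤ᵇ_; _<ᵇ_; z≤n; s≤s; NonZero; _≤?_; _/_; _%_; >-nonZero)
open import Data.Nat.DivMod using (m≡m%n+[m/n]*n; m%n<n)
open import Data.Nat.ListAction using (sum)
open import Data.Nat.Properties
open import Data.Nat.Tactic.RingSolver using (solve-∀)
open import Data.Product using (_×_; _,_; proj₁; proj₂; swap)
open import Data.Sum using (_⊎_; inj₁; inj₂) renaming (swap to swap⊎)
open import Function using (_∘_; id; Equivalence)
open import Relation.Nullary using (¬_; yes; no)
open import Relation.Nullary.Decidable using (T?)
open import Relation.Binary.PropositionalEquality

module +-Semigroup = CommutativeSemigroupProperties +-commutativeSemigroup
module *-Semigroup = CommutativeSemigroupProperties *-commutativeSemigroup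

-- Written as in Defs.dMoves, so that the two agree definitionally.
𝟙 : Bool → ℕ
𝟙 b = if b then 1 else 0

𝟙-mono : ∀ {b c} → (T b → T c) → 𝟙 b ≤ 𝟙 c
𝟙-mono {true}  {true}  _   = ≤-refl
𝟙-mono {true}  {false} b⇒c = ⊥-elim (b⇒c _)
𝟙-mono {false}         _   = z≤n

𝟙-∨ : ∀ b c → 𝟙 (b ∨ c) ≤ 𝟙 b + 𝟙 c
𝟙-∨ true  c = s≤s z≤n
𝟙-∨ false c = ≤-refl

count : {A : Set} → (A → Bool) → List A → ℕ
count p xs = length (filterᵇ p xs)

module _ {A : Set} where

  count-∷ : (p : A → Bool) (x : A) (xs : List A) → count p (x ∷ xs) ≡ 𝟙 (p x) + count p xs
  count-∷ p x xs with p x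
  ... | true  = refl
  ... | false = refl

  count-∷∷ : (p : A → Bool) (x y : A) (zs : List A) → count p (x ∷ y ∷ zs) ≡ 𝟙 (p x) + 𝟙 (p y) + count p zs
  count-∷∷ p x y zs =
    trans (count-∷ p x (y ∷ zs)) (trans (cong (𝟙 (p x) +_) (count-∷ p y zs)) (sym (+-assoc (𝟙 (p x)) _ _)))

  count-++ : (p : A → Bool) (xs ys : List A) → count p (xs ++ ys) ≡ count p xs + count p ys
  count-++ p xs ys = trans (cong length (filter-++ (T? ∘ p) xs ys)) (length-++ (filterᵇ p xs))

  count≤length : (p : A → Bool) (xs : List A) → count p xs ≤ length xs
  count≤length p = length-filter (T? ∘ p)

  count≡0 : (p : A → Bool) (xs : List A) → All (λ x → ¬ T (p x)) xs → count p xs ≡ 0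
  count≡0 p xs none = cong length (filter-none (T? ∘ p) none)

  count-mono : {p q : A → Bool} (xs : List A) → (∀ {x} → x ∈ xs → T (p x) → T (q x)) →
               count p xs ≤ count q xs
  count-mono {p} {q} []       p⇒q = z≤n
  count-mono {p} {q} (x ∷ xs) p⇒q rewrite count-∷ p x xs | count-∷ q x xs =
    +-mono-≤ (𝟙-mono (p⇒q (here refl))) (count-mono xs (p⇒q ∘ there))

  count-cong : {p q : A → Bool} (xs : List A) → (∀ x → p x ≡ q x) → count p xs ≡ count q xs
  count-cong {p} {q} []       p≗q = refl
  count-cong {p} {q} (x ∷ xs) p≗q rewrite count-∷ p x xs | count-∷ q x xs | p≗q x =
    cong (𝟙 (q x) +_) (count-cong xs p≗q)

  count-≤-+ : (p q r : A → Bool) (xs : List A) → (∀ x → 𝟙 (p x) ≤ 𝟙 (q x) + 𝟙 (r x)) →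
              count p xs ≤ count q xs + count r xs
  count-≤-+ p q r []       p≤q+r = z≤n
  count-≤-+ p q r (x ∷ xs) p≤q+r rewrite count-∷ p x xs | count-∷ q x xs | count-∷ r x xs =
    ≤-trans (+-mono-≤ (p≤q+r x) (count-≤-+ p q r xs p≤q+r))
            (≤-reflexive (+-Semigroup.interchange (𝟙 (q x)) (𝟙 (r x)) (count q xs) (count r xs)))

  count-concatMap : {B : Set} (p : A → Bool) (f : B → List A) (ys : List B) →
                    count p (concatMap f ys) ≡ sum (map (count p ∘ f) ys)
  count-concatMap p f []       = refl
  count-concatMap p f (y ∷ ys) =
    trans (count-++ p (f y) (concatMap f ys)) (cong (count p (f y) +_) (count-concatMap p f ys))

  length-concatMap : {B : Set} (n : ℕ) (f : B → List A) (ys : List B) → (∀ y → length (f y) ≡ n) →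
                     length (concatMap f ys) ≡ length ys * n
  length-concatMap n f []       _  = refl
  length-concatMap n f (y ∷ ys) ∣f∣≡n =
    trans (length-++ (f y)) (cong₂ _+_ (∣f∣≡n y) (length-concatMap n f ys ∣f∣≡n))

count-map : {A B : Set} (p : B → Bool) (f : A → B) (xs : List A) → count p (map f xs) ≡ count (p ∘ f) xs
count-map p f []       = refl
count-map p f (x ∷ xs) rewrite count-∷ p (f x) (map f xs) | count-∷ (p ∘ f) x xs =
  cong (𝟙 (p (f x)) +_) (count-map p f xs)

sum-map-mono : {B : Set} (g h : B → ℕ) (ys : List B) → (∀ y → g y ≤ h y) → sum (map g ys) ≤ sum (map h ys)
sum-map-mono g h []       g≤h = z≤n
sum-map-mono g h (y ∷ ys) g≤h = +-mono-≤ (g≤h y) (sum-map-mono g h ys g≤h)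

sum-map-*ʳ : {B : Set} (g : B → ℕ) (n : ℕ) (ys : List B) → sum (map g ys) * n ≡ sum (map (λ y → g y * n) ys)
sum-map-*ʳ g n []       = refl
sum-map-*ʳ g n (y ∷ ys) = trans (*-distribʳ-+ n (g y) _) (cong (g y * n +_) (sum-map-*ʳ g n ys))

sum-map-affine : {B : Set} (q : B → Bool) (X Y : ℕ) (ys : List B) →
                 sum (map (λ y → X + 𝟙 (q y) * Y) ys) ≡ length ys * X + count q ys * Y
sum-map-affine q X Y []       = refl
sum-map-affine q X Y (y ∷ ys) rewrite sum-map-affine q X Y ys | count-∷ q y ys =
  rearrange X (𝟙 (q y)) Y (length ys) (count q ys)
  where
  rearrange : ∀ X i Y l k → X + i * Y + (l * X + k * Y) ≡ X + l * X + (i + k) * Y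
  rearrange = solve-∀

closedPath : ℕ → ℕ → List ℕ → List (ℕ × ℕ)
closedPath w y []       = (y , w) ∷ []
closedPath w y (z ∷ zs) = (y , z) ∷ closedPath w z zs

-- Defs.edges is defined through a local helper; dropping the first edge exposes it.
drop1-edges : ∀ x y zs → drop 1 (edges (x ∷ y ∷ zs)) ≡ closedPath x y zs
drop1-edges x y []       = refl
drop1-edges x y (z ∷ zs) = cong ((y , z) ∷_) (drop1-edges x z zs)

edges≡closedPath : ∀ x xs → edges (x ∷ xs) ≡ closedPath x x xs
edges≡closedPath x []       = refl
edges≡closedPath x (y ∷ zs) = cong ((x , y) ∷_) (drop1-edges x y zs)

length-closedPath : ∀ w y ys → length (closedPath w y ys) ≡ suc (length ys)
length-closedPath w y []       = refl
length-closedPath w y (z ∷ zs) = cong suc (length-closedPath w z zs)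

length-edges : ∀ x xs → length (edges (x ∷ xs)) ≡ suc (length xs)
length-edges x xs rewrite edges≡closedPath x xs = length-closedPath x x xs

-- Edge indices are clamped as in Defs.edgeAt.
subdivide : ℕ → ℕ → List (ℕ × ℕ) → List (ℕ × ℕ)
subdivide k       v []               = []
subdivide zero    v ((p , q) ∷ es)   = (p , v) ∷ (v , q) ∷ es
subdivide (suc k) v ((p , q) ∷ [])   = (p , v) ∷ (v , q) ∷ []
subdivide (suc k) v (e ∷ e' ∷ es)    = e ∷ subdivide k v (e' ∷ es)

deleteAt : {A : Set} → ℕ → List A → List A
deleteAt k       []            = []
deleteAt zero    (e ∷ es)      = es
deleteAt (suc k) (e ∷ [])      = []
deleteAt (suc k) (e ∷ e' ∷ es) = e ∷ deleteAt k (e' ∷ es)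

insertAt : ℕ → ℕ → List ℕ → List ℕ
insertAt zero    v ys = v ∷ ys
insertAt (suc k) v ys = insertAfter k v ys

insertAfter-∷ : ∀ k v z zs → insertAfter k v (z ∷ zs) ≡ z ∷ insertAt k v zs
insertAfter-∷ zero    v z zs = refl
insertAfter-∷ (suc k) v z zs = refl

subdivide-∷ : ∀ k v e w z zs → subdivide (suc k) v (e ∷ closedPath w z zs) ≡ e ∷ subdivide k v (closedPath w z zs)
subdivide-∷ k v e w z []       = refl
subdivide-∷ k v e w z (x ∷ zs) = refl

closedPath-insertAt : ∀ w y ys k v → closedPath w y (insertAt k v ys) ≡ subdivide k v (closedPath w y ys)
closedPath-insertAt w y []       zero    v = refl
closedPath-insertAt w y (z ∷ zs) zero    v = refl
closedPath-insertAt w y []       (suc k) v = refl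
closedPath-insertAt w y (z ∷ zs) (suc k) v
  rewrite insertAfter-∷ k v z zs | subdivide-∷ k v (y , z) w z zs =
  cong ((y , z) ∷_) (closedPath-insertAt w z zs k v)

edges-insertAfter : ∀ k v x xs → edges (insertAfter k v (x ∷ xs)) ≡ subdivide k v (edges (x ∷ xs))
edges-insertAfter zero    v x xs rewrite edges≡closedPath x xs =
  trans (edges≡closedPath x (v ∷ xs)) (closedPath-insertAt x x xs zero v)
edges-insertAfter (suc k) v x xs rewrite edges≡closedPath x xs | edges≡closedPath x (insertAfter k v xs) =
  closedPath-insertAt x x xs (suc k) v

data NonEmpty {A : Set} : List A → Set where
  nonEmpty : ∀ x xs → NonEmpty (x ∷ xs)

closedPath-nonEmpty : ∀ w y ys → NonEmpty (closedPath w y ys)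
closedPath-nonEmpty w y []       = nonEmpty _ _
closedPath-nonEmpty w y (z ∷ zs) = nonEmpty _ _

edges-nonEmpty : ∀ x xs → NonEmpty (edges (x ∷ xs))
edges-nonEmpty x xs rewrite edges≡closedPath x xs = closedPath-nonEmpty x x xs

edgeAt∈ : ∀ k (e : ℕ × ℕ) es → edgeAt k (e ∷ es) ∈ e ∷ es
edgeAt∈ zero    e []        = here refl
edgeAt∈ zero    e (_ ∷ _)   = here refl
edgeAt∈ (suc k) e []        = here refl
edgeAt∈ (suc k) e (e' ∷ es) = there (edgeAt∈ k e' es)

∈-deleteAt : {A : Set} {x : A} → ∀ k xs → x ∈ deleteAt k xs → x ∈ xs
∈-deleteAt zero    (y ∷ ys)      x∈       = there x∈
∈-deleteAt (suc k) (y ∷ y' ∷ ys) (here eq) = here eq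
∈-deleteAt (suc k) (y ∷ y' ∷ ys) (there x∈) = there (∈-deleteAt k (y' ∷ ys) x∈)

∈-subdivide : ∀ {g} k v e es → g ∈ subdivide k v (e ∷ es) →
  let f = edgeAt k (e ∷ es) in g ∈ deleteAt k (e ∷ es) ⊎ g ≡ (proj₁ f , v) ⊎ g ≡ (v , proj₂ f)
∈-subdivide zero    v (p , q) []        (here eq)          = inj₂ (inj₁ eq)
∈-subdivide zero    v (p , q) []        (there (here eq))  = inj₂ (inj₂ eq)
∈-subdivide zero    v (p , q) (_ ∷ _)   (here eq)          = inj₂ (inj₁ eq)
∈-subdivide zero    v (p , q) (_ ∷ _)   (there (here eq))  = inj₂ (inj₂ eq)
∈-subdivide zero    v (p , q) (_ ∷ _)   (there (there g∈)) = inj₁ g∈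
∈-subdivide (suc k) v (p , q) []        (here eq)          = inj₂ (inj₁ eq)
∈-subdivide (suc k) v (p , q) []        (there (here eq))  = inj₂ (inj₂ eq)
∈-subdivide (suc k) v e       (e' ∷ es) (here eq)          = inj₁ (here eq)
∈-subdivide (suc k) v e       (e' ∷ es) (there g∈) with ∈-subdivide k v e' es g∈
... | inj₁ g∈old = inj₁ (there g∈old)
... | inj₂ new   = inj₂ new

module _ (p : ℕ × ℕ → Bool) where

  count-deleteAt : ∀ k e es →
    count p (e ∷ es) ≡ 𝟙 (p (edgeAt k (e ∷ es))) + count p (deleteAt k (e ∷ es))
  count-deleteAt zero    e []        = count-∷ p e []
  count-deleteAt zero    e (e' ∷ es) = count-∷ p e (e' ∷ es)
  count-deleteAt (suc k) e []        = count-∷ p e []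
  count-deleteAt (suc k) e (e' ∷ es) = begin
    count p (e ∷ e' ∷ es)                      ≡⟨ count-∷ p e (e' ∷ es) ⟩
    𝟙 (p e) + count p (e' ∷ es)               ≡⟨ cong (𝟙 (p e) +_) (count-deleteAt k e' es) ⟩
    𝟙 (p e) + (𝟙 (p f) + count p rest)        ≡⟨ +-Semigroup.x∙yz≈y∙xz (𝟙 (p e)) (𝟙 (p f)) (count p rest) ⟩
    𝟙 (p f) + (𝟙 (p e) + count p rest)        ≡⟨ cong (𝟙 (p f) +_) (count-∷ p e rest) ⟨
    𝟙 (p f) + count p (e ∷ rest)              ∎
    where
    open ≡-Reasoning
    f = edgeAt k (e' ∷ es)
    rest = deleteAt k (e' ∷ es)

  count-subdivide : ∀ k v e es → let f = edgeAt k (e ∷ es) in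
    count p (subdivide k v (e ∷ es)) ≡ 𝟙 (p (proj₁ f , v)) + 𝟙 (p (v , proj₂ f)) + count p (deleteAt k (e ∷ es))
  count-subdivide zero    v (a , b) []        = count-∷∷ p (a , v) (v , b) []
  count-subdivide zero    v (a , b) (e' ∷ es) = count-∷∷ p (a , v) (v , b) (e' ∷ es)
  count-subdivide (suc k) v (a , b) []        = count-∷∷ p (a , v) (v , b) []
  count-subdivide (suc k) v e       (e' ∷ es) = begin
    count p (e ∷ subdivide k v (e' ∷ es))               ≡⟨ count-∷ p e _ ⟩
    𝟙 (p e) + count p (subdivide k v (e' ∷ es))        ≡⟨ cong (𝟙 (p e) +_) (count-subdivide k v e' es) ⟩
    𝟙 (p e) + (new + count p rest)                     ≡⟨ +-Semigroup.x∙yz≈y∙xz (𝟙 (p e)) new (count p rest) ⟩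
    new + (𝟙 (p e) + count p rest)                     ≡⟨ cong (new +_) (count-∷ p e rest) ⟨
    new + count p (e ∷ rest)                           ∎
    where
    open ≡-Reasoning
    f = edgeAt k (e' ∷ es)
    new = 𝟙 (p (proj₁ f , v)) + 𝟙 (p (v , proj₂ f))
    rest = deleteAt k (e' ∷ es)

SameEdge : ℕ × ℕ → ℕ × ℕ → Set
SameEdge e f = e ≡ f ⊎ e ≡ swap f

sameEdge⇒SameEdge : ∀ e f → T (sameEdge e f) → SameEdge e f
sameEdge⇒SameEdge (u , v) (u' , v') h with Equivalence.to T-∨ h
... | inj₁ h' = let (u≡ , v≡) = Equivalence.to T-∧ h' in inj₁ (cong₂ _,_ (≡ᵇ⇒≡ u u' u≡) (≡ᵇ⇒≡ v v' v≡))
... | inj₂ h' = let (u≡ , v≡) = Equivalence.to T-∧ h' in inj₂ (cong₂ _,_ (≡ᵇ⇒≡ u v' u≡) (≡ᵇ⇒≡ v u' v≡))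

SameEdge⇒sameEdge : ∀ e f → SameEdge e f → T (sameEdge e f)
SameEdge⇒sameEdge (u , v) _ (inj₁ refl) = Equivalence.from T-∨ (inj₁ (Equivalence.from T-∧ (≡⇒≡ᵇ u u refl , ≡⇒≡ᵇ v v refl)))
SameEdge⇒sameEdge (u , v) _ (inj₂ refl) = Equivalence.from T-∨ (inj₂ (Equivalence.from T-∧ (≡⇒≡ᵇ u u refl , ≡⇒≡ᵇ v v refl)))

SameEdge-sym : ∀ e f → SameEdge e f → SameEdge f e
SameEdge-sym (u , v) (u' , v') (inj₁ refl) = inj₁ refl
SameEdge-sym (u , v) (u' , v') (inj₂ refl) = inj₂ refl

SameEdge-swap : ∀ e f → SameEdge e f → SameEdge (swap e) f
SameEdge-swap (u , v) (u' , v') (inj₁ refl) = inj₂ refl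
SameEdge-swap (u , v) (u' , v') (inj₂ refl) = inj₁ refl

occurs : ℕ × ℕ → List (ℕ × ℕ) → Bool
occurs e = any (sameEdge e)

occurs⇒ : ∀ {e E} → T (occurs e E) → ∃ λ g → g ∈ E × SameEdge e g
occurs⇒ {e} {E} h with find (any⁻ (sameEdge e) E h)
... | g , g∈E , same = g , g∈E , sameEdge⇒SameEdge e g same

occurs⇐ : ∀ {e g E} → g ∈ E → SameEdge e g → T (occurs e E)
occurs⇐ {e} {g} g∈E same = any⁺ (sameEdge e) (lose g∈E (SameEdge⇒sameEdge e g same))

IsEndpoint : ℕ → ℕ × ℕ → Set
IsEndpoint x f = x ≡ proj₁ f ⊎ x ≡ proj₂ f

endpoint : ℕ × ℕ → ℕ → Bool
endpoint (u , w) z = (z ≡ᵇ u) ∨ (z ≡ᵇ w)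

touches : ℕ × ℕ → ℕ × ℕ → Bool
touches e (x , y) = endpoint e x ∨ endpoint e y

T-∨⁺ : ∀ {a b} → T a ⊎ T b → T (a ∨ b)
T-∨⁺ = Equivalence.from T-∨

endpoint-intro : ∀ e z → IsEndpoint z e → T (endpoint e z)
endpoint-intro (u , w) z (inj₁ refl) = T-∨⁺ {u ≡ᵇ u} (inj₁ (≡⇒≡ᵇ u u refl))
endpoint-intro (u , w) z (inj₂ refl) = T-∨⁺ {w ≡ᵇ u} (inj₂ (≡⇒≡ᵇ w w refl))

touches-intro : ∀ e f → IsEndpoint (proj₁ e) f ⊎ IsEndpoint (proj₂ e) f → T (touches e f)
touches-intro e (x , y) (inj₁ (inj₁ eq)) = T-∨⁺ {endpoint e x} (inj₁ (endpoint-intro e x (inj₁ (sym eq))))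
touches-intro e (x , y) (inj₁ (inj₂ eq)) = T-∨⁺ {endpoint e x} (inj₂ (endpoint-intro e y (inj₁ (sym eq))))
touches-intro e (x , y) (inj₂ (inj₁ eq)) = T-∨⁺ {endpoint e x} (inj₁ (endpoint-intro e x (inj₂ (sym eq))))
touches-intro e (x , y) (inj₂ (inj₂ eq)) = T-∨⁺ {endpoint e x} (inj₂ (endpoint-intro e y (inj₂ (sym eq))))

Fresh : ℕ → ℕ × ℕ → Set
Fresh m e = proj₁ e < m × proj₂ e < m

fresh-not-endpoint : ∀ {m} e → Fresh m e → ¬ IsEndpoint m e
fresh-not-endpoint e (e₁<m , _) (inj₁ m≡e₁) = <-irrefl (sym m≡e₁) e₁<m
fresh-not-endpoint e (_ , e₂<m) (inj₂ m≡e₂) = <-irrefl (sym m≡e₂) e₂<m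

SameEdge-endpoint : ∀ {x} e g → SameEdge e g → IsEndpoint x e → IsEndpoint x g
SameEdge-endpoint (u , v) (u' , v') (inj₁ refl) = id
SameEdge-endpoint (u , v) (u' , v') (inj₂ refl) = swap⊎

module Subdivision {m : ℕ} (c : ℕ) (eb : ℕ × ℕ) (ebs : List (ℕ × ℕ)) (freshB : All (Fresh m) (eb ∷ ebs)) where

  f = edgeAt c (eb ∷ ebs)
  subdivided = subdivide c m (eb ∷ ebs)

  fresh-f : Fresh m f
  fresh-f = All.lookup freshB (edgeAt∈ c eb ebs)

  occurs-old : ∀ e → Fresh m e → T (occurs e subdivided) → T (occurs e (eb ∷ ebs))
  occurs-old e fresh-e h with occurs⇒ h
  ... | g , g∈ , same with ∈-subdivide c m eb ebs g∈
  ...   | inj₁ g∈old        = occurs⇐ (∈-deleteAt c _ g∈old) same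
  ...   | inj₂ (inj₁ g≡f₁m) = ⊥-elim (fresh-not-endpoint e fresh-e
                                (SameEdge-endpoint g e (SameEdge-sym e g same) (inj₂ (sym (cong proj₂ g≡f₁m)))))
  ...   | inj₂ (inj₂ g≡mf₂) = ⊥-elim (fresh-not-endpoint e fresh-e
                                (SameEdge-endpoint g e (SameEdge-sym e g same) (inj₁ (sym (cong proj₁ g≡mf₂)))))

  neighbour : ∀ {x} g → g ∈ subdivided → SameEdge (x , m) g → IsEndpoint x f
  neighbour {x} g g∈ same with ∈-subdivide c m eb ebs g∈ | same
  ... | inj₁ g∈old        | _       = ⊥-elim (fresh-not-endpoint g (All.lookup freshB (∈-deleteAt c _ g∈old))
                                       (SameEdge-endpoint (x , m) g same (inj₂ refl)))
  ... | inj₂ (inj₁ g≡f₁m) | inj₁ eq = inj₁ (cong proj₁ (trans eq g≡f₁m))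
  ... | inj₂ (inj₁ g≡f₁m) | inj₂ eq = ⊥-elim (fresh-not-endpoint f fresh-f (inj₁ (cong proj₂ (trans eq (cong swap g≡f₁m)))))
  ... | inj₂ (inj₂ g≡mf₂) | inj₁ eq = ⊥-elim (fresh-not-endpoint f fresh-f (inj₂ (cong proj₂ (trans eq g≡mf₂))))
  ... | inj₂ (inj₂ g≡mf₂) | inj₂ eq = inj₂ (cong proj₁ (trans eq (cong swap g≡mf₂)))

common-subdivide : ∀ {m} k c Ea Eb → NonEmpty Ea → NonEmpty Eb → All (Fresh m) Ea → All (Fresh m) Eb →
  let e = edgeAt k Ea; t = touches e (edgeAt c Eb) in
  count (λ g → occurs g (subdivide c m Eb)) (subdivide k m Ea) + 𝟙 (occurs e Eb)
    ≤ count (λ g → occurs g Eb) Ea + (𝟙 t + 𝟙 t)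
common-subdivide {m} k c .(ea ∷ eas) .(eb ∷ ebs) (nonEmpty ea eas) (nonEmpty eb ebs) freshA freshB = begin
  count p' (subdivide k m Ea) + 𝟙 (p e)
    ≡⟨ cong (_+ 𝟙 (p e)) (count-subdivide p' k m ea eas) ⟩
  𝟙 (p' (proj₁ e , m)) + 𝟙 (p' (m , proj₂ e)) + count p' (deleteAt k Ea) + 𝟙 (p e)
    ≤⟨ +-monoˡ-≤ (𝟙 (p e)) (+-mono-≤ (+-mono-≤ (𝟙-mono new-left) (𝟙-mono new-right))
                                      (count-mono (deleteAt k Ea) old)) ⟩
  𝟙 t + 𝟙 t + count p (deleteAt k Ea) + 𝟙 (p e)
    ≡⟨ +-Semigroup.xy∙z≈zy∙x (𝟙 t + 𝟙 t) (count p (deleteAt k Ea)) (𝟙 (p e)) ⟩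
  𝟙 (p e) + count p (deleteAt k Ea) + (𝟙 t + 𝟙 t)
    ≡⟨ cong (_+ (𝟙 t + 𝟙 t)) (count-deleteAt p k ea eas) ⟨
  count p Ea + (𝟙 t + 𝟙 t) ∎
  where
  open ≤-Reasoning
  open Subdivision c eb ebs freshB
  Ea = ea ∷ eas
  e = edgeAt k Ea
  t = touches e f
  p p' : ℕ × ℕ → Bool
  p g = occurs g (eb ∷ ebs)
  p' g = occurs g subdivided
  new-left : T (p' (proj₁ e , m)) → T t
  new-left h with occurs⇒ h
  ... | g , g∈ , same = touches-intro e f (inj₁ (neighbour g g∈ same))
  new-right : T (p' (m , proj₂ e)) → T t
  new-right h with occurs⇒ h
  ... | g , g∈ , same = touches-intro e f (inj₂ (neighbour g g∈ (SameEdge-swap (m , proj₂ e) g same)))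
  old : ∀ {g} → g ∈ deleteAt k Ea → T (p' g) → T (p g)
  old {g} g∈ = occurs-old g (All.lookup freshA (∈-deleteAt k Ea g∈))

fresh-closedPath : ∀ {m} w y ys → w < m → All (_< m) (y ∷ ys) → All (Fresh m) (closedPath w y ys)
fresh-closedPath w y []       w<m (y<m ∷ [])            = (y<m , w<m) ∷ []
fresh-closedPath w y (z ∷ zs) w<m (y<m ∷ zs<m@(z<m ∷ _)) = (y<m , z<m) ∷ fresh-closedPath w z zs w<m zs<m

fresh-edges : ∀ {m} x xs → All (_< m) (x ∷ xs) → All (Fresh m) (edges (x ∷ xs))
fresh-edges x xs xs<m@(x<m ∷ _) rewrite edges≡closedPath x xs = fresh-closedPath x x xs x<m xs<m

commonEdges-insertAfter : ∀ {m} k c a b → NonEmpty a → NonEmpty b → All (_< m) a → All (_< m) b →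
  let e = edgeAt k (edges a); t = touches e (edgeAt c (edges b)) in
  commonEdges (insertAfter k m a) (insertAfter c m b) + 𝟙 (isEdge e b) ≤ commonEdges a b + (𝟙 t + 𝟙 t)
commonEdges-insertAfter {m} k c .(x ∷ xs) .(y ∷ ys) (nonEmpty x xs) (nonEmpty y ys) a<m b<m
  rewrite edges-insertAfter k m x xs | edges-insertAfter c m y ys =
  common-subdivide k c (edges (x ∷ xs)) (edges (y ∷ ys)) (edges-nonEmpty x xs) (edges-nonEmpty y ys)
    (fresh-edges x xs a<m) (fresh-edges y ys b<m)

length-insertAfter : ∀ k v l → length (insertAfter k v l) ≡ suc (length l)
length-insertAfter k       v []      = refl
length-insertAfter zero    v (x ∷ l) = refl
length-insertAfter (suc k) v (x ∷ l) = cong suc (length-insertAfter k v l)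

All-insertAfter : {P : ℕ → Set} → ∀ k v l → All P l → P v → All P (insertAfter k v l)
All-insertAfter k       v []      _          pv = pv ∷ []
All-insertAfter zero    v (x ∷ l) (px ∷ pl) pv = px ∷ pv ∷ pl
All-insertAfter (suc k) v (x ∷ l) (px ∷ pl) pv = px ∷ All-insertAfter k v l pl pv

nonEmpty-insertAfter : ∀ k v l → NonEmpty (insertAfter k v l)
nonEmpty-insertAfter k       v []      = nonEmpty _ _
nonEmpty-insertAfter zero    v (x ∷ l) = nonEmpty _ _
nonEmpty-insertAfter (suc k) v (x ∷ l) = nonEmpty _ _

count-insertAfter : (p : ℕ → Bool) → ∀ k v l → count p (insertAfter k v l) ≡ 𝟙 (p v) + count p l
count-insertAfter p k       v []      = count-∷ p v []
count-insertAfter p zero    v (x ∷ l) = begin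
  count p (x ∷ v ∷ l)                ≡⟨ count-∷∷ p x v l ⟩
  𝟙 (p x) + 𝟙 (p v) + count p l     ≡⟨ +-assoc (𝟙 (p x)) _ _ ⟩
  𝟙 (p x) + (𝟙 (p v) + count p l)   ≡⟨ +-Semigroup.x∙yz≈y∙xz (𝟙 (p x)) (𝟙 (p v)) (count p l) ⟩
  𝟙 (p v) + (𝟙 (p x) + count p l)   ≡⟨ cong (𝟙 (p v) +_) (count-∷ p x l) ⟨
  𝟙 (p v) + count p (x ∷ l)         ∎
  where open ≡-Reasoning
count-insertAfter p (suc k) v (x ∷ l) = begin
  count p (x ∷ insertAfter k v l)          ≡⟨ count-∷ p x _ ⟩
  𝟙 (p x) + count p (insertAfter k v l)   ≡⟨ cong (𝟙 (p x) +_) (count-insertAfter p k v l) ⟩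
  𝟙 (p x) + (𝟙 (p v) + count p l)         ≡⟨ +-Semigroup.x∙yz≈y∙xz (𝟙 (p x)) (𝟙 (p v)) (count p l) ⟩
  𝟙 (p v) + (𝟙 (p x) + count p l)         ≡⟨ cong (𝟙 (p v) +_) (count-∷ p x l) ⟨
  𝟙 (p v) + count p (x ∷ l)               ∎
  where open ≡-Reasoning

Distinct : List ℕ → Set
Distinct l = ∀ u → count (_≡ᵇ u) l ≤ 1

count-≡ᵇ-absent : ∀ v l → All (_< v) l → count (_≡ᵇ v) l ≡ 0
count-≡ᵇ-absent v l l<v = count≡0 (_≡ᵇ v) l (All.map (λ x<v x≡v → <-irrefl (≡ᵇ⇒≡ _ _ x≡v) x<v) l<v)

distinct-insertAfter : ∀ k v l → All (_< v) l → Distinct l → Distinct (insertAfter k v l)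
distinct-insertAfter k v l l<v distinct u rewrite count-insertAfter (_≡ᵇ u) k v l with v ≡ᵇ u in v≡ᵇu
... | false = distinct u
... | true with refl ← ≡ᵇ⇒≡ v u (subst T (sym v≡ᵇu) _) rewrite count-≡ᵇ-absent v l l<v = ≤-refl

record PlayInvariant (b a : List ℕ) : Set where
  field
    bob-nonEmpty   : NonEmpty b
    alice-nonEmpty : NonEmpty a
    bob-distinct   : Distinct b
    bob-bounded    : All (_< suc (length b)) b
    alice-bounded  : All (_< suc (length b)) a

bobStep : ℕ → List ℕ → List ℕ
bobStep c b = insertAfter c (suc (length b)) b

playInvariant-step : ∀ s b a c → PlayInvariant b a → PlayInvariant (bobStep c b) (aliceStep s b a)
playInvariant-step s b a c inv = record
  { bob-nonEmpty   = nonEmpty-insertAfter c m b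
  ; alice-nonEmpty = nonEmpty-insertAfter (s b) m a
  ; bob-distinct   = distinct-insertAfter c m b bob-bounded bob-distinct
  ; bob-bounded    = subst (λ n → All (_< suc n) (bobStep c b)) (sym (length-insertAfter c m b))
                       (All-insertAfter c m b (All.map m<n⇒m<1+n bob-bounded) ≤-refl)
  ; alice-bounded  = subst (λ n → All (_< suc n) (aliceStep s b a)) (sym (length-insertAfter c m b))
                       (All-insertAfter (s b) m a (All.map m<n⇒m<1+n alice-bounded) ≤-refl)
  }
  where
  open PlayInvariant inv
  m = suc (length b)

touchingChoice : Strategy → List ℕ → List ℕ → ℕ → Bool
touchingChoice s b a c = touches (edgeAt (s b) (edges a)) (edgeAt c (edges b))

touchingMoves : Strategy → List ℕ → List ℕ → List ℕ → ℕ
touchingMoves s b a []       = 0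
touchingMoves s b a (c ∷ cs) = 𝟙 (touchingChoice s b a c) + touchingMoves s (bobStep c b) (aliceStep s b a) cs

dMove+cMove≡1 : ∀ s b a → 𝟙 (isDMove s b a) + 𝟙 (isEdge (edgeAt (s b) (edges a)) b) ≡ 1
dMove+cMove≡1 s b a with isEdge (edgeAt (s b) (edges a)) b
... | true  = refl
... | false = refl

moves≤dMoves+common+2touching : ∀ s b a cs → PlayInvariant b a →
  length cs ≤ dMoves s b a cs + commonEdges a b + (touchingMoves s b a cs + touchingMoves s b a cs)
moves≤dMoves+common+2touching s b a []       _   = z≤n
moves≤dMoves+common+2touching s b a (c ∷ cs) inv = begin
  suc (length cs)                      ≡⟨ cong (_+ length cs) (dMove+cMove≡1 s b a) ⟨
  d + e + length cs                    ≤⟨ +-monoʳ-≤ (d + e) (moves≤dMoves+common+2touching s b' a' cs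
                                                                 (playInvariant-step s b a c inv)) ⟩
  d + e + (D' + S' + (T' + T'))        ≡⟨ regroup₁ d e D' S' T' ⟩
  d + D' + (S' + e) + (T' + T')        ≤⟨ +-monoˡ-≤ (T' + T') (+-monoʳ-≤ (d + D') oneStep) ⟩
  d + D' + (S + (t + t)) + (T' + T')   ≡⟨ regroup₂ d D' S t T' ⟩
  d + D' + S + ((t + T') + (t + T'))   ∎
  where
  open ≤-Reasoning
  open PlayInvariant inv
  b' = bobStep c b
  a' = aliceStep s b a
  d = 𝟙 (isDMove s b a)
  e = 𝟙 (isEdge (edgeAt (s b) (edges a)) b)
  t = 𝟙 (touchingChoice s b a c)
  D' = dMoves s b' a' cs
  S' = commonEdges a' b'
  T' = touchingMoves s b' a' cs
  S = commonEdges a b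
  oneStep : S' + e ≤ S + (t + t)
  oneStep = commonEdges-insertAfter (s b) c a b alice-nonEmpty bob-nonEmpty alice-bounded bob-bounded
  regroup₁ : ∀ d e D S T → d + e + (D + S + (T + T)) ≡ d + D + (S + e) + (T + T)
  regroup₁ = solve-∀
  regroup₂ : ∀ d D S t T → d + D + (S + (t + t)) + (T + T) ≡ d + D + S + ((t + T) + (t + T))
  regroup₂ = solve-∀

count-proj₁-closedPath : (q : ℕ → Bool) → ∀ w y ys → count (λ f → q (proj₁ f)) (closedPath w y ys) ≡ count q (y ∷ ys)
count-proj₁-closedPath q w y []       = trans (count-∷ (λ f → q (proj₁ f)) (y , w) []) (sym (count-∷ q y []))
count-proj₁-closedPath q w y (z ∷ zs) rewrite count-∷ (λ f → q (proj₁ f)) (y , z) (closedPath w z zs) | count-∷ q y (z ∷ zs) =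
  cong (𝟙 (q y) +_) (count-proj₁-closedPath q w z zs)

count-proj₂-closedPath : (q : ℕ → Bool) → ∀ w y ys → count (λ f → q (proj₂ f)) (closedPath w y ys) ≡ count q (w ∷ ys)
count-proj₂-closedPath q w y []       = trans (count-∷ (λ f → q (proj₂ f)) (y , w) []) (sym (count-∷ q w []))
count-proj₂-closedPath q w y (z ∷ zs) = begin
  count (λ f → q (proj₂ f)) ((y , z) ∷ closedPath w z zs)   ≡⟨ count-∷ (λ f → q (proj₂ f)) (y , z) _ ⟩
  𝟙 (q z) + count (λ f → q (proj₂ f)) (closedPath w z zs)   ≡⟨ cong (𝟙 (q z) +_) (count-proj₂-closedPath q w z zs) ⟩
  𝟙 (q z) + count q (w ∷ zs)                                ≡⟨ cong (𝟙 (q z) +_) (count-∷ q w zs) ⟩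
  𝟙 (q z) + (𝟙 (q w) + count q zs)                         ≡⟨ +-Semigroup.x∙yz≈y∙xz (𝟙 (q z)) (𝟙 (q w)) (count q zs) ⟩
  𝟙 (q w) + (𝟙 (q z) + count q zs)                         ≡⟨ cong (𝟙 (q w) +_) (count-∷ q z zs) ⟨
  𝟙 (q w) + count q (z ∷ zs)                                ≡⟨ count-∷ q w (z ∷ zs) ⟨
  count q (w ∷ z ∷ zs)                                      ∎
  where open ≡-Reasoning

applyUpTo-edgeAt : ∀ (e : ℕ × ℕ) es → applyUpTo (λ c → edgeAt c (e ∷ es)) (suc (length es)) ≡ e ∷ es
applyUpTo-edgeAt e []        = refl
applyUpTo-edgeAt e (e' ∷ es) = cong (e ∷_) (applyUpTo-edgeAt e' es)

count-edgeAt-upTo : (q : ℕ × ℕ → Bool) → ∀ E → NonEmpty E → count (λ c → q (edgeAt c E)) (upTo (length E)) ≡ count q E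
count-edgeAt-upTo q .(e ∷ es) (nonEmpty e es) = begin
  count (q ∘ at) (upTo (suc (length es)))          ≡⟨ count-map q at (upTo (suc (length es))) ⟨
  count q (map at (upTo (suc (length es))))        ≡⟨ cong (count q) (map-upTo at (suc (length es))) ⟩
  count q (applyUpTo at (suc (length es)))         ≡⟨ cong (count q) (applyUpTo-edgeAt e es) ⟩
  count q (e ∷ es)                                 ∎
  where
  open ≡-Reasoning
  at = λ c → edgeAt c (e ∷ es)

count-endpoint≤2 : ∀ e l → Distinct l → count (endpoint e) l ≤ 2
count-endpoint≤2 (u , w) l distinct = begin
  count (endpoint (u , w)) l               ≤⟨ count-≤-+ _ (_≡ᵇ u) (_≡ᵇ w) l (λ z → 𝟙-∨ (z ≡ᵇ u) (z ≡ᵇ w)) ⟩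
  count (_≡ᵇ u) l + count (_≡ᵇ w) l       ≤⟨ +-mono-≤ (distinct u) (distinct w) ⟩
  2                                        ∎
  where open ≤-Reasoning

touchingChoices≤4 : ∀ s b a → PlayInvariant b a → count (touchingChoice s b a) (upTo (length b)) ≤ 4
touchingChoices≤4 s b@(x ∷ xs) a inv = begin
  count (touchingChoice s b a) (upTo (length b))
    ≡⟨ cong (λ n → count (touchingChoice s b a) (upTo n)) (length-edges x xs) ⟨
  count (λ c → touches e (edgeAt c (edges b))) (upTo (length (edges b)))
    ≡⟨ count-edgeAt-upTo (touches e) (edges b) (edges-nonEmpty x xs) ⟩
  count (touches e) (edges b)
    ≡⟨ cong (count (touches e)) (edges≡closedPath x xs) ⟩
  count (touches e) (closedPath x x xs)
    ≤⟨ count-≤-+ _ (λ f → endpoint e (proj₁ f)) (λ f → endpoint e (proj₂ f)) (closedPath x x xs)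
                 (λ f → 𝟙-∨ (endpoint e (proj₁ f)) (endpoint e (proj₂ f))) ⟩
  count (λ f → endpoint e (proj₁ f)) (closedPath x x xs) + count (λ f → endpoint e (proj₂ f)) (closedPath x x xs)
    ≡⟨ cong₂ _+_ (count-proj₁-closedPath (endpoint e) x x xs) (count-proj₂-closedPath (endpoint e) x x xs) ⟩
  count (endpoint e) b + count (endpoint e) b
    ≤⟨ +-mono-≤ (count-endpoint≤2 e b bob-distinct) (count-endpoint≤2 e b bob-distinct) ⟩
  4 ∎
  where
  open ≤-Reasoning
  open PlayInvariant inv
  e = edgeAt (s b) (edges a)

^-distribʳ-* : ∀ x y n → (x * y) ^ n ≡ x ^ n * y ^ n
^-distribʳ-* x y zero    = refl
^-distribʳ-* x y (suc n) rewrite ^-distribʳ-* x y n = regroup x y (x ^ n) (y ^ n)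
  where
  regroup : ∀ x y a b → x * y * (a * b) ≡ x * a * (y * b)
  regroup = solve-∀

binomial-two-terms : ∀ d J → d ^ suc J + suc J * d ^ J ≤ suc d ^ suc J
binomial-two-terms d zero = ≤-reflexive (expand d)
  where
  expand : ∀ d → d * 1 + 1 * 1 ≡ suc d * 1
  expand = solve-∀
binomial-two-terms d (suc J) = begin
  d * (d * P) + suc (suc J) * (d * P)                ≤⟨ m≤m+n _ (suc J * P) ⟩
  d * (d * P) + suc (suc J) * (d * P) + suc J * P    ≡⟨ factor d J P ⟩
  suc d * (d * P + suc J * P)                        ≤⟨ *-monoʳ-≤ (suc d) (binomial-two-terms d J) ⟩
  suc d * suc d ^ suc J                              ∎
  where
  open ≤-Reasoning
  P = d ^ J
  factor : ∀ d J P → d * (d * P) + suc (suc J) * (d * P) + suc J * P ≡ suc d * (d * P + suc J * P)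
  factor = solve-∀

binomial-two-terms-4* : ∀ d J → (4 * d) ^ suc J + 4 * suc J * (4 * d) ^ J ≤ (4 * suc d) ^ suc J
binomial-two-terms-4* d J rewrite ^-distribʳ-* 4 d J | ^-distribʳ-* 4 (suc d) (suc J) = begin
  4 * d * (A * P) + 4 * suc J * (A * P)   ≡⟨ factor d J A P ⟩
  4 * A * (d * P + suc J * P)             ≤⟨ *-monoʳ-≤ (4 * A) (binomial-two-terms d J) ⟩
  4 * A * suc d ^ suc J                   ∎
  where
  open ≤-Reasoning
  A = 4 ^ J
  P = d ^ J
  factor : ∀ d J A P → 4 * d * (A * P) + 4 * suc J * (A * P) ≡ 4 * A * (d * P + suc J * P)
  factor = solve-∀

^-cancelʳ-≤ : ∀ n .{{_ : NonZero n}} {x y} → x ^ n ≤ y ^ n → x ≤ y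
^-cancelʳ-≤ n {x} {y} xⁿ≤yⁿ = ≮⇒≥ (λ y<x → <⇒≱ (^-monoˡ-< n y<x) xⁿ≤yⁿ)

-- (1 + 1/n)^k ≤ n/(n − k) for n = k + t.
[1+k+t]^k*t≤[k+t]^[1+k] : ∀ k t → suc (k + t) ^ k * t ≤ (k + t) ^ suc k
[1+k+t]^k*t≤[k+t]^[1+k] zero    t = ≤-reflexive (*-comm 1 t)
[1+k+t]^k*t≤[k+t]^[1+k] (suc k) t = begin
  suc n * suc n ^ k * t     ≡⟨ regroup₁ (suc n) (suc n ^ k) t ⟩
  suc n ^ k * (suc n * t)   ≤⟨ *-monoʳ-≤ (suc n ^ k) [1+n]*t≤n*[1+t] ⟩
  suc n ^ k * (n * suc t)   ≡⟨ regroup₂ (suc n ^ k) n (suc t) ⟩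
  n * (suc n ^ k * suc t)   ≤⟨ *-monoʳ-≤ n ih ⟩
  n * n ^ suc k             ∎
  where
  open ≤-Reasoning
  n = suc (k + t)
  ih : suc n ^ k * suc t ≤ n ^ suc k
  ih = subst (λ z → suc z ^ k * suc t ≤ z ^ suc k) (+-suc k t) ([1+k+t]^k*t≤[k+t]^[1+k] k (suc t))
  [1+n]*t≤n*[1+t] : suc n * t ≤ n * suc t
  [1+n]*t≤n*[1+t] = begin
    t + n * t   ≤⟨ +-monoˡ-≤ (n * t) (≤-trans (m≤n+m t k) (n≤1+n (k + t))) ⟩
    n + n * t   ≡⟨ *-suc n t ⟨
    n * suc t   ∎
  regroup₁ : ∀ a b c → a * b * c ≡ b * (a * c)
  regroup₁ = solve-∀
  regroup₂ : ∀ a b c → a * (b * c) ≡ b * (a * c)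
  regroup₂ = solve-∀

half : ∀ m → ∃ λ h → m ≡ h + h ⊎ m ≡ suc (h + h)
half zero    = 0 , inj₁ refl
half (suc m) with half m
... | h , inj₁ m≡2h   = h , inj₂ (cong suc m≡2h)
... | h , inj₂ m≡1+2h = suc h , inj₁ (trans (cong suc m≡1+2h) (cong suc (sym (+-suc h h))))

-- For m = 2h, (1 + 1/m)^h ≤ m/h = 2; square it.
[1+m]^m≤4*m^m-even : ∀ h → suc (h + h) ^ (h + h) ≤ 4 * (h + h) ^ (h + h)
[1+m]^m≤4*m^m-even zero       = s≤s z≤n
[1+m]^m≤4*m^m-even h@(suc _) = *-cancelʳ-≤ _ _ (h * h) (begin
  suc m ^ (h + h) * (h * h)    ≡⟨ cong (_* (h * h)) (^-distribˡ-+-* (suc m) h h) ⟩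
  X * X * (h * h)              ≡⟨ regroup₁ X h ⟩
  (X * h) * (X * h)            ≤⟨ *-mono-≤ X*h≤m*Y X*h≤m*Y ⟩
  (m * Y) * (m * Y)            ≡⟨ regroup₂ h Y ⟩
  4 * (Y * Y) * (h * h)        ≡⟨ cong (λ z → 4 * z * (h * h)) (^-distribˡ-+-* m h h) ⟨
  4 * m ^ (h + h) * (h * h)    ∎)
  where
  open ≤-Reasoning
  m = h + h
  X = suc m ^ h
  Y = m ^ h
  X*h≤m*Y : X * h ≤ m * Y
  X*h≤m*Y = [1+k+t]^k*t≤[k+t]^[1+k] h h
  regroup₁ : ∀ X h → X * X * (h * h) ≡ (X * h) * (X * h)
  regroup₁ = solve-∀
  regroup₂ : ∀ h Y → ((h + h) * Y) * ((h + h) * Y) ≡ 4 * (Y * Y) * (h * h)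
  regroup₂ = solve-∀

-- For m = 2h + 1, (1 + 1/m)^h ≤ m/(h + 1); square it and use (m + 1) m ≤ (2h + 2)².
[1+m]^m≤4*m^m-odd : ∀ h → suc (suc (h + h)) ^ suc (h + h) ≤ 4 * suc (h + h) ^ suc (h + h)
[1+m]^m≤4*m^m-odd h = *-cancelʳ-≤ _ _ (h' * h') (begin
  suc m ^ m * (h' * h')                ≡⟨ cong (λ z → suc m * z * (h' * h')) (^-distribˡ-+-* (suc m) h h) ⟩
  suc m * (X * X) * (h' * h')          ≡⟨ regroup₁ (suc m) X h' ⟩
  suc m * ((X * h') * (X * h'))        ≤⟨ *-monoʳ-≤ (suc m) (*-mono-≤ X*h'≤m*Y X*h'≤m*Y) ⟩
  suc m * ((m * Y) * (m * Y))          ≡⟨ regroup₂ (suc m) m Y ⟩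
  suc m * m * (m * (Y * Y))            ≤⟨ *-monoˡ-≤ (m * (Y * Y)) (*-monoʳ-≤ (suc m) (≤-trans (n≤1+n m) (≤-reflexive (2+2h≡2*h' h)))) ⟩
  suc m * (2 * h') * (m * (Y * Y))     ≡⟨ cong (λ z → z * (2 * h') * (m * (Y * Y))) (2+2h≡2*h' h) ⟩
  2 * h' * (2 * h') * (m * (Y * Y))    ≡⟨ regroup₃ h' m Y ⟩
  4 * (m * (Y * Y)) * (h' * h')        ≡⟨ cong (λ z → 4 * (m * z) * (h' * h')) (^-distribˡ-+-* m h h) ⟨
  4 * m ^ m * (h' * h')                ∎)
  where
  open ≤-Reasoning
  m = suc (h + h)
  h' = suc h
  X = suc m ^ h
  Y = m ^ h
  X*h'≤m*Y : X * h' ≤ m * Y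
  X*h'≤m*Y = subst (λ z → suc z ^ h * h' ≤ z ^ suc h) (+-suc h h) ([1+k+t]^k*t≤[k+t]^[1+k] h h')
  2+2h≡2*h' : ∀ h → suc (suc (h + h)) ≡ 2 * suc h
  2+2h≡2*h' = solve-∀
  regroup₁ : ∀ a X s → a * (X * X) * (s * s) ≡ a * ((X * s) * (X * s))
  regroup₁ = solve-∀
  regroup₂ : ∀ a m Y → a * ((m * Y) * (m * Y)) ≡ a * m * (m * (Y * Y))
  regroup₂ = solve-∀
  regroup₃ : ∀ s m Y → 2 * s * (2 * s) * (m * (Y * Y)) ≡ 4 * (m * (Y * Y)) * (s * s)
  regroup₃ = solve-∀

[1+m]^m≤4*m^m : ∀ m → suc m ^ m ≤ 4 * m ^ m
[1+m]^m≤4*m^m m with half m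
... | h , inj₁ refl = [1+m]^m≤4*m^m-even h
... | h , inj₂ refl = [1+m]^m≤4*m^m-odd h

m^m≤4^m*m! : ∀ m → m ^ m ≤ 4 ^ m * m !
m^m≤4^m*m! zero    = s≤s z≤n
m^m≤4^m*m! (suc m) = begin
  suc m * suc m ^ m              ≤⟨ *-monoʳ-≤ (suc m) ([1+m]^m≤4*m^m m) ⟩
  suc m * (4 * m ^ m)            ≤⟨ *-monoʳ-≤ (suc m) (*-monoʳ-≤ 4 (m^m≤4^m*m! m)) ⟩
  suc m * (4 * (4 ^ m * m !))    ≡⟨ regroup (suc m) (4 ^ m) (m !) ⟩
  4 * 4 ^ m * (suc m * m !)      ∎
  where
  open ≤-Reasoning
  regroup : ∀ a b c → a * (4 * (b * c)) ≡ 4 * b * (a * c)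
  regroup = solve-∀

n^j*n!≤j!*n^n-below : ∀ n t j → j + t ≡ n → n ^ j * n ! ≤ j ! * n ^ n
n^j*n!≤j!*n^n-below n zero    j refl rewrite +-identityʳ j = ≤-reflexive (*-comm (j ^ j) (j !))
n^j*n!≤j!*n^n-below n (suc t) j j+t≡n = *-cancelˡ-≤ n {{n≢0}} (begin
  n * (n ^ j * n !)        ≡⟨ *-assoc n (n ^ j) (n !) ⟨
  n ^ suc j * n !          ≤⟨ n^j*n!≤j!*n^n-below n t (suc j) (trans (sym (+-suc j t)) j+t≡n) ⟩
  suc j * j ! * n ^ n      ≡⟨ *-assoc (suc j) (j !) (n ^ n) ⟩
  suc j * (j ! * n ^ n)    ≤⟨ *-monoˡ-≤ (j ! * n ^ n) 1+j≤n ⟩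
  n * (j ! * n ^ n)        ∎)
  where
  open ≤-Reasoning
  1+j+t≡n : suc (j + t) ≡ n
  1+j+t≡n = trans (sym (+-suc j t)) j+t≡n
  1+j≤n : suc j ≤ n
  1+j≤n = subst (suc j ≤_) 1+j+t≡n (s≤s (m≤m+n j t))
  n≢0 : NonZero n
  n≢0 = subst NonZero 1+j+t≡n _

n^j*n!≤j!*n^n-above : ∀ n t → n ^ (n + t) * n ! ≤ (n + t) ! * n ^ n
n^j*n!≤j!*n^n-above n zero    rewrite +-identityʳ n = ≤-reflexive (*-comm (n ^ n) (n !))
n^j*n!≤j!*n^n-above n (suc t) rewrite +-suc n t = begin
  n * n ^ (n + t) * n !                  ≡⟨ *-assoc n _ _ ⟩
  n * (n ^ (n + t) * n !)                ≤⟨ *-monoʳ-≤ n (n^j*n!≤j!*n^n-above n t) ⟩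
  n * ((n + t) ! * n ^ n)                ≤⟨ *-monoˡ-≤ _ (≤-trans (m≤m+n n t) (n≤1+n (n + t))) ⟩
  suc (n + t) * ((n + t) ! * n ^ n)      ≡⟨ *-assoc (suc (n + t)) ((n + t) !) (n ^ n) ⟨
  suc (n + t) * (n + t) ! * n ^ n        ∎
  where open ≤-Reasoning

n^j*n!≤j!*n^n : ∀ n j → n ^ j * n ! ≤ j ! * n ^ n
n^j*n!≤j!*n^n n j with ≤-total j n
... | inj₁ j≤n = let (t , j+t≡n) = m≤n⇒∃[o]m+o≡n j≤n in n^j*n!≤j!*n^n-below n t j j+t≡n
... | inj₂ n≤j with m≤n⇒∃[o]m+o≡n n≤j
...   | t , refl = n^j*n!≤j!*n^n-above n t

x^j≤j!*4^x : ∀ x j → x ^ j ≤ j ! * 4 ^ x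
x^j≤j!*4^x x j = *-cancelʳ-≤ _ _ (x !) {{x !≢0}} (begin
  x ^ j * x !             ≤⟨ n^j*n!≤j!*n^n x j ⟩
  j ! * x ^ x             ≤⟨ *-monoʳ-≤ (j !) (m^m≤4^m*m! x) ⟩
  j ! * (4 ^ x * x !)     ≡⟨ *-assoc (j !) _ _ ⟨
  j ! * 4 ^ x * x !       ∎)
  where open ≤-Reasoning

length-choiceSeqs-suc : ∀ b₀ d → length (choiceSeqs b₀ (suc d)) ≡ b₀ * length (choiceSeqs (suc b₀) d)
length-choiceSeqs-suc b₀ d =
  trans (length-concatMap (length rest) (λ c → map (c ∷_) rest) (upTo b₀) (λ c → length-map (c ∷_) rest))
        (cong (_* length rest) (length-upTo b₀))
  where rest = choiceSeqs (suc b₀) d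

count-choiceSeqs-suc : (p : List ℕ → Bool) → ∀ b₀ d →
  count p (choiceSeqs b₀ (suc d)) ≡ sum (map (λ c → count (p ∘ (c ∷_)) (choiceSeqs (suc b₀) d)) (upTo b₀))
count-choiceSeqs-suc p b₀ d =
  trans (count-concatMap p (λ c → map (c ∷_) rest) (upTo b₀))
        (cong sum (map-cong (λ c → count-map p (c ∷_) rest) (upTo b₀)))
  where rest = choiceSeqs (suc b₀) d

atLeastTouching : Strategy → ℕ → List ℕ → List ℕ → List ℕ → Bool
atLeastTouching s K b a cs = K ≤ᵇ touchingMoves s b a cs

suc≤ᵇsuc : ∀ m n → (suc m ≤ᵇ suc n) ≡ (m ≤ᵇ n)
suc≤ᵇsuc zero    n = refl
suc≤ᵇsuc (suc m) n = refl

-- At most 4 of the ≥ b₀ choices of a round are touching, so P(≥ K touching moves in d rounds)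
-- is at most C(d,K) (4/b₀)^K ≤ (4d/b₀)^K / K!.
touching-tail : ∀ s d K b a b₀ → b₀ ≡ length b → PlayInvariant b a →
  count (atLeastTouching s K b a) (choiceSeqs b₀ d) * (b₀ ^ K * K !) ≤ (4 * d) ^ K * length (choiceSeqs b₀ d)
touching-tail s d zero b a b₀ _ _ = begin
  count (atLeastTouching s 0 b a) (choiceSeqs b₀ d) * 1   ≡⟨ *-identityʳ _ ⟩
  count (atLeastTouching s 0 b a) (choiceSeqs b₀ d)       ≤⟨ count≤length _ (choiceSeqs b₀ d) ⟩
  length (choiceSeqs b₀ d)                                ≡⟨ *-identityˡ _ ⟨
  1 * length (choiceSeqs b₀ d)                            ∎
  where open ≤-Reasoning
touching-tail s zero    (suc J) b a b₀ _ _ = z≤n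
touching-tail s (suc d) (suc J) b a .(length b) refl inv = begin
  count (atLeastTouching s K b a) (choiceSeqs b₀ (suc d)) * Z
    ≡⟨ cong (_* Z) (count-choiceSeqs-suc (atLeastTouching s K b a) b₀ d) ⟩
  sum (map branch (upTo b₀)) * Z
    ≡⟨ sum-map-*ʳ branch Z (upTo b₀) ⟩
  sum (map (λ c → branch c * Z) (upTo b₀))
    ≤⟨ sum-map-mono _ _ (upTo b₀) branch-bound ⟩
  sum (map (λ c → X + 𝟙 (touchingChoice s b a c) * Y) (upTo b₀))
    ≡⟨ sum-map-affine (touchingChoice s b a) X Y (upTo b₀) ⟩
  length (upTo b₀) * X + count (touchingChoice s b a) (upTo b₀) * Y
    ≤⟨ +-mono-≤ (≤-reflexive (cong (_* X) (length-upTo b₀))) (*-monoˡ-≤ Y (touchingChoices≤4 s b a inv)) ⟩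
  b₀ * X + 4 * Y
    ≡⟨ factor b₀ N (4 * d) ((4 * d) ^ J) (suc J) ⟩
  b₀ * N * ((4 * d) ^ K + 4 * suc J * (4 * d) ^ J)
    ≤⟨ *-monoʳ-≤ (b₀ * N) (binomial-two-terms-4* d J) ⟩
  b₀ * N * (4 * suc d) ^ K
    ≡⟨ *-comm (b₀ * N) _ ⟩
  (4 * suc d) ^ K * (b₀ * N)
    ≡⟨ cong ((4 * suc d) ^ K *_) (length-choiceSeqs-suc b₀ d) ⟨
  (4 * suc d) ^ K * length (choiceSeqs b₀ (suc d)) ∎
  where
  open ≤-Reasoning
  K = suc J
  b₀ = length b
  rest = choiceSeqs (suc b₀) d
  N = length rest
  Z = b₀ ^ K * K !
  X = (4 * d) ^ K * N
  Y = b₀ * suc J * ((4 * d) ^ J * N)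
  factor : ∀ b₀ N Q P j → b₀ * (Q * P * N) + 4 * (b₀ * j * (P * N)) ≡ b₀ * N * (Q * P + 4 * j * P)
  factor = solve-∀
  branch : ℕ → ℕ
  branch c = count (atLeastTouching s K b a ∘ (c ∷_)) rest
  branch-bound : ∀ c → branch c * Z ≤ X + 𝟙 (touchingChoice s b a c) * Y
  branch-bound c with touchingChoice s b a c
  ... | false = begin
    G * Z                         ≤⟨ *-monoʳ-≤ G (*-monoˡ-≤ (K !) (^-monoˡ-≤ K (n≤1+n b₀))) ⟩
    G * (suc b₀ ^ K * K !)        ≤⟨ touching-tail s d K b' a' (suc b₀) (sym (length-insertAfter c (suc b₀) b))
                                                   (playInvariant-step s b a c inv) ⟩
    X                             ≡⟨ +-identityʳ X ⟨
    X + 0 * Y                     ∎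
    where
    b' = bobStep c b
    a' = aliceStep s b a
    G = count (atLeastTouching s K b' a') rest
  ... | true = begin
    G * (b₀ * b₀ ^ J * (suc J * J !))        ≡⟨ regroup G b₀ (b₀ ^ J) (suc J) (J !) ⟩
    b₀ * suc J * (G * (b₀ ^ J * J !))        ≤⟨ *-monoʳ-≤ (b₀ * suc J) (*-monoʳ-≤ G (*-monoˡ-≤ (J !) (^-monoˡ-≤ J (n≤1+n b₀)))) ⟩
    b₀ * suc J * (G * (suc b₀ ^ J * J !))    ≡⟨ cong (λ n → b₀ * suc J * (n * (suc b₀ ^ J * J !)))
                                                      (count-cong rest (λ cs → suc≤ᵇsuc J (touchingMoves s b' a' cs))) ⟩
    b₀ * suc J * (G' * (suc b₀ ^ J * J !))   ≤⟨ *-monoʳ-≤ (b₀ * suc J)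
                                                   (touching-tail s d J b' a' (suc b₀) (sym (length-insertAfter c (suc b₀) b))
                                                                  (playInvariant-step s b a c inv)) ⟩
    Y                                        ≤⟨ m≤n+m Y X ⟩
    X + Y                                    ≡⟨ cong (X +_) (*-identityˡ Y) ⟨
    X + 1 * Y                                ∎
    where
    b' = bobStep c b
    a' = aliceStep s b a
    G = count (λ cs → suc J ≤ᵇ suc (touchingMoves s b' a' cs)) rest
    G' = count (atLeastTouching s J b' a') rest
    regroup : ∀ G b B j F → G * (b * B * (j * F)) ≡ b * j * (G * (B * F))
    regroup = solve-∀

module ExponentialBound (n K : ℕ) (2n≤8K : n * 2 ≤ K * 8) (128≤K : 128 ≤ K) where

  private
    N = K * 8
    D = 4 ^ N
    R = (K !) ^ 8

    K^N≤D*R : K ^ N ≤ D * R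
    K^N≤D*R = begin
      K ^ N                 ≡⟨ ^-*-assoc K K 8 ⟨
      (K ^ K) ^ 8           ≤⟨ ^-monoˡ-≤ 8 (m^m≤4^m*m! K) ⟩
      (4 ^ K * K !) ^ 8     ≡⟨ ^-distribʳ-* (4 ^ K) (K !) 8 ⟩
      (4 ^ K) ^ 8 * R       ≡⟨ cong (_* R) (^-*-assoc 4 K 8) ⟩
      D * R                 ∎
      where open ≤-Reasoning

    2*D*D≤R : 2 * (D * D) ≤ R
    2*D*D≤R = *-cancelˡ-≤ D {{m^n≢0 4 N}} (begin
      D * (2 * (D * D))     ≡⟨ *-Semigroup.x∙yz≈y∙xz D 2 (D * D) ⟩
      2 * (D * (D * D))     ≡⟨ cong (λ z → 2 * (D * z)) (^-distribʳ-* 4 4 N) ⟨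
      2 * (D * 16 ^ N)      ≡⟨ cong (2 *_) (^-distribʳ-* 4 16 N) ⟨
      2 * 64 ^ N            ≤⟨ *-monoˡ-≤ (64 ^ N) (^-monoʳ-≤ 2 1≤N) ⟩
      2 ^ N * 64 ^ N        ≡⟨ ^-distribʳ-* 2 64 N ⟨
      128 ^ N               ≤⟨ ^-monoˡ-≤ N 128≤K ⟩
      K ^ N                 ≤⟨ K^N≤D*R ⟩
      D * R                 ∎)
      where
      open ≤-Reasoning
      1≤N : 1 ≤ N
      1≤N = ≤-trans (s≤s z≤n) (≤-trans 128≤K (m≤m*n K 8))

    term-bound : ∀ j → n ^ j * D * 2 ^ suc j ≤ j ! * R
    term-bound j = begin
      n ^ j * D * (2 * 2 ^ j)    ≡⟨ regroup₁ (n ^ j) D (2 ^ j) ⟩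
      2 * (n ^ j * 2 ^ j) * D    ≡⟨ cong (λ z → 2 * z * D) (^-distribʳ-* n 2 j) ⟨
      2 * (n * 2) ^ j * D        ≤⟨ *-monoˡ-≤ D (*-monoʳ-≤ 2 (≤-trans (^-monoˡ-≤ j 2n≤8K) (x^j≤j!*4^x N j))) ⟩
      2 * (j ! * D) * D          ≡⟨ regroup₂ (j !) D ⟩
      j ! * (2 * (D * D))        ≤⟨ *-monoʳ-≤ (j !) 2*D*D≤R ⟩
      j ! * R                    ∎
      where
      open ≤-Reasoning
      regroup₁ : ∀ a D p → a * D * (2 * p) ≡ 2 * (a * p) * D
      regroup₁ = solve-∀
      regroup₂ : ∀ f D → 2 * (f * D) * D ≡ f * (2 * (D * D))
      regroup₂ = solve-∀

    -- Σ_{j ≤ k} n^j D / j!  ≤  R (1 − 2^-(k+1)), since the j-th term is at most R / 2^(j+1).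
    partial-sum-bound : ∀ k → expPartial n k * D * 2 ^ suc k + k ! * R ≤ k ! * R * 2 ^ suc k
    partial-sum-bound zero = begin
      1 * D * 2 + 1 * R    ≤⟨ +-monoˡ-≤ (1 * R) (term-bound 0) ⟩
      1 * R + 1 * R        ≡⟨ double R ⟩
      1 * R * 2            ∎
      where
      open ≤-Reasoning
      double : ∀ R → 1 * R + 1 * R ≡ 1 * R * 2
      double = solve-∀
    partial-sum-bound (suc k) = +-cancelʳ-≤ Z _ _ (begin
      (suc k * E + B) * D * (2 * P) + suc k * F * R + Z   ≡⟨ regroup₁ (suc k) E B D P F R ⟩
      2 * suc k * (E * D * P + F * R) + B * D * (2 * P)   ≤⟨ +-mono-≤ (*-monoʳ-≤ (2 * suc k) (partial-sum-bound k))
                                                                     (term-bound (suc k)) ⟩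
      2 * suc k * (F * R * P) + suc k * F * R             ≡⟨ regroup₂ (suc k) F R P ⟩
      suc k * F * R * (2 * P) + Z                         ∎)
      where
      open ≤-Reasoning
      E = expPartial n k
      F = k !
      P = 2 ^ suc k
      B = n ^ suc k
      Z = suc k * F * R
      regroup₁ : ∀ s E B D P F R →
        (s * E + B) * D * (2 * P) + s * F * R + s * F * R ≡ 2 * s * (E * D * P + F * R) + B * D * (2 * P)
      regroup₁ = solve-∀
      regroup₂ : ∀ s F R P → 2 * s * (F * R * P) + s * F * R ≡ s * F * R * (2 * P) + s * F * R
      regroup₂ = solve-∀

    expPartial*D≤k!*R : ∀ k → expPartial n k * D ≤ k ! * R
    expPartial*D≤k!*R k =
      *-cancelʳ-≤ _ _ (2 ^ suc k) {{m^n≢0 2 (suc k)}} (≤-trans (m≤m+n _ (k ! * R)) (partial-sum-bound k))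

  b*4^K≤a*K! : ∀ a b k → b ^ 8 * k ! ≤ a ^ 8 * expPartial n k → b * 4 ^ K ≤ a * K !
  b*4^K≤a*K! a b k b⁸k!≤a⁸E = ^-cancelʳ-≤ 8 (begin
    (b * 4 ^ K) ^ 8         ≡⟨ ^-distribʳ-* b (4 ^ K) 8 ⟩
    b ^ 8 * (4 ^ K) ^ 8     ≡⟨ cong (b ^ 8 *_) (^-*-assoc 4 K 8) ⟩
    b ^ 8 * D               ≤⟨ b⁸D≤a⁸R ⟩
    a ^ 8 * R               ≡⟨ ^-distribʳ-* a (K !) 8 ⟨
    (a * K !) ^ 8           ∎)
    where
    open ≤-Reasoning
    b⁸D≤a⁸R : b ^ 8 * D ≤ a ^ 8 * R
    b⁸D≤a⁸R = *-cancelˡ-≤ (k !) {{k !≢0}} (begin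
      k ! * (b ^ 8 * D)               ≡⟨ regroup₁ (k !) (b ^ 8) D ⟩
      b ^ 8 * k ! * D                 ≤⟨ *-monoˡ-≤ D b⁸k!≤a⁸E ⟩
      a ^ 8 * expPartial n k * D      ≡⟨ *-assoc (a ^ 8) _ D ⟩
      a ^ 8 * (expPartial n k * D)    ≤⟨ *-monoʳ-≤ (a ^ 8) (expPartial*D≤k!*R k) ⟩
      a ^ 8 * (k ! * R)               ≡⟨ *-Semigroup.x∙yz≈y∙xz (a ^ 8) (k !) R ⟩
      k ! * (a ^ 8 * R)               ∎)
      where
      regroup₁ : ∀ f x D → f * (x * D) ≡ x * f * D
      regroup₁ = solve-∀

length-cycle : ∀ {m xs} → IsCycle m xs → length xs ≡ m
length-cycle base                      = refl
length-cycle (step {m} {xs} {k} cyc _) = trans (length-insertAfter k (suc m) xs) (cong suc (length-cycle cyc))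

cycle-nonEmpty : ∀ {m xs} → IsCycle m xs → NonEmpty xs
cycle-nonEmpty base                      = nonEmpty _ _
cycle-nonEmpty (step {m} {xs} {k} cyc _) = nonEmpty-insertAfter k (suc m) xs

cycle-bounded : ∀ {m xs} → IsCycle m xs → All (_< suc m) xs
cycle-bounded base = ≤ᵇ⇒≤ 2 4 _ ∷ ≤ᵇ⇒≤ 3 4 _ ∷ ≤ᵇ⇒≤ 4 4 _ ∷ []
cycle-bounded (step {m} {xs} {k} cyc _) =
  All-insertAfter k (suc m) xs (All.map m<n⇒m<1+n (cycle-bounded cyc)) ≤-refl

cycle3-distinct : Distinct cycle3
cycle3-distinct zero                      = z≤n
cycle3-distinct (suc zero)                = s≤s z≤n
cycle3-distinct (suc (suc zero))          = s≤s z≤n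
cycle3-distinct (suc (suc (suc zero)))    = s≤s z≤n
cycle3-distinct (suc (suc (suc (suc _)))) = z≤n

cycle-distinct : ∀ {m xs} → IsCycle m xs → Distinct xs
cycle-distinct base                      = cycle3-distinct
cycle-distinct (step {m} {xs} {k} cyc _) = distinct-insertAfter k (suc m) xs (cycle-bounded cyc) (cycle-distinct cyc)

>⇒≤ᵇ≡false : ∀ {m n} → n < m → (m ≤ᵇ n) ≡ false
>⇒≤ᵇ≡false {m} {n} n<m with m ≤ᵇ n in eq
... | false = refl
... | true  = ⊥-elim (<⇒≱ n<m (≤ᵇ⇒≤ m n (subst T (sym eq) _)))

length-restrict< : ∀ {n xs} → IsCycle n xs → ∀ j → j < n → length (restrict j xs) < n
length-restrict< base zero                _ = s≤s z≤n
length-restrict< base (suc zero)          _ = s≤s (s≤s z≤n)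
length-restrict< base (suc (suc zero))    _ = s≤s (s≤s (s≤s z≤n))
length-restrict< base (suc (suc (suc j))) (s≤s (s≤s (s≤s ())))
length-restrict< (step {m} {xs} {k} cyc _) j j<1+m
  rewrite count-insertAfter (_≤ᵇ j) k (suc m) xs | >⇒≤ᵇ≡false j<1+m =
  s≤s (≤-trans (count≤length (_≤ᵇ j) xs) (≤-reflexive (length-cycle cyc)))

cycle-size≥3 : ∀ {n xs} → IsCycle n xs → 3 ≤ n
cycle-size≥3 base          = ≤-refl
cycle-size≥3 (step cyc _) = m≤n⇒m≤1+n (cycle-size≥3 cyc)

aliceCycle-nonEmpty : ∀ s β d → NonEmpty (aliceCycle s β d)
aliceCycle-nonEmpty s β zero    = nonEmpty _ _
aliceCycle-nonEmpty s β (suc d) = nonEmpty-insertAfter _ _ _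

aliceCycle-bounded : ∀ {n} s β → IsCycle n β → ∀ d → 3 + d ≤ n → All (_< suc n) (aliceCycle s β d)
aliceCycle-bounded s β cyc zero    3≤n =
  s≤s (≤-trans (≤ᵇ⇒≤ 1 3 _) 3≤n) ∷ s≤s (≤-trans (≤ᵇ⇒≤ 2 3 _) 3≤n) ∷ s≤s 3≤n ∷ []
aliceCycle-bounded s β cyc (suc d) 3+d<n =
  All-insertAfter _ _ _ (aliceCycle-bounded s β cyc d (<⇒≤ 3+d<n)) (s≤s (length-restrict< cyc (3 + d) 3+d<n))

initialInvariant : ∀ {n₀} s β → IsCycle n₀ β → PlayInvariant β (aliceAt s n₀ β)
initialInvariant {n₀} s β cyc = record
  { bob-nonEmpty   = cycle-nonEmpty cyc
  ; alice-nonEmpty = aliceCycle-nonEmpty s β (n₀ ∸ 3)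
  ; bob-distinct   = cycle-distinct cyc
  ; bob-bounded    = subst (λ n → All (_< suc n) β) (sym (length-cycle cyc)) (cycle-bounded cyc)
  ; alice-bounded  = subst (λ n → All (_< suc n) (aliceAt s n₀ β)) (sym (length-cycle cyc))
                       (aliceCycle-bounded s β cyc (n₀ ∸ 3) (≤-reflexive (m+[n∸m]≡n (cycle-size≥3 cyc))))
  }

-- At m = 6 the hypothesis gives S³ ≤ 6! n, i.e. S ≤ (720 n)^(1/3), which is below n/9 once n ≥ 900.
lnSq⇒9S≤n : ∀ S n → 900 ≤ n → LnSqBound S n → 9 * S ≤ n
lnSq⇒9S≤n S n 900≤n lnSq with 9 * S ≤? n
... | yes 9S≤n = 9S≤n
... | no 9S≰n  = ⊥-elim (<-irrefl refl (≤-<-trans 810000n≤524880n 524880n<810000n))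
  where
  open ≤-Reasoning
  n≤9S : n ≤ 9 * S
  n≤9S = <⇒≤ (≰⇒> 9S≰n)
  S³≤720n : S * (S * (S * 1)) ≤ n * 720
  S³≤720n = ≤-trans (m≤n+m _ _) (proj₁ (lnSq 6))
  810000n≤524880n : 810000 * n ≤ 524880 * n
  810000n≤524880n = begin
    900 * 900 * n                  ≤⟨ *-monoˡ-≤ n (*-mono-≤ 900≤n 900≤n) ⟩
    n * n * n                      ≤⟨ *-mono-≤ (*-mono-≤ n≤9S n≤9S) n≤9S ⟩
    9 * S * (9 * S) * (9 * S)      ≡⟨ cube S ⟩
    729 * (S * (S * (S * 1)))      ≤⟨ *-monoʳ-≤ 729 S³≤720n ⟩
    729 * (n * 720)                ≡⟨ product n ⟩
    524880 * n                     ∎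
    where
    cube : ∀ S → 9 * S * (9 * S) * (9 * S) ≡ 729 * (S * (S * (S * 1)))
    cube = solve-∀
    product : ∀ n → 729 * (n * 720) ≡ 524880 * n
    product = solve-∀
  524880n<810000n : 524880 * n < 810000 * n
  524880n<810000n = *-monoˡ-< n {{>-nonZero (≤-trans (s≤s z≤n) 900≤n)}} (≤ᵇ⇒≤ 524881 810000 _)

-- K = ⌊n/4⌋ + 1.
choose-K : ∀ n → 900 ≤ n → ∃ λ K → n * 2 ≤ K * 8 × 128 ≤ K × K * 18 ≤ n * 5
choose-K n 900≤n with n / 4 | n % 4 | m≡m%n+[m/n]*n n 4 | m%n<n n 4
... | q | r | refl | s≤s r≤3 = suc q , 2n≤8K , ≤-trans (≤ᵇ⇒≤ 128 226 _) (s≤s 225≤q) , 18K≤5n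
  where
  open ≤-Reasoning
  225≤q : 225 ≤ q
  225≤q with 225 ≤? q
  ... | yes 225≤q = 225≤q
  ... | no 225≰q  = ⊥-elim (<⇒≱ (s≤s (+-mono-≤ r≤3 (*-monoˡ-≤ 4 (≤-pred (≰⇒> 225≰q))))) 900≤n)
  2n≤8K : (r + q * 4) * 2 ≤ suc q * 8
  2n≤8K = begin
    (r + q * 4) * 2     ≡⟨ *-distribʳ-+ 2 r (q * 4) ⟩
    r * 2 + q * 4 * 2   ≤⟨ +-monoˡ-≤ (q * 4 * 2) (≤-trans (*-monoˡ-≤ 2 r≤3) (≤ᵇ⇒≤ 6 8 _)) ⟩
    8 + q * 4 * 2       ≡⟨ expand q ⟩
    suc q * 8           ∎
    where
    expand : ∀ q → 8 + q * 4 * 2 ≡ suc q * 8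
    expand = solve-∀
  18K≤5n : suc q * 18 ≤ (r + q * 4) * 5
  18K≤5n = begin
    suc q * 18          ≡⟨ expand q ⟩
    18 + q * 18         ≤⟨ +-monoˡ-≤ (q * 18) (≤-trans (≤ᵇ⇒≤ 18 450 _) (*-monoˡ-≤ 2 225≤q)) ⟩
    q * 2 + q * 18      ≡⟨ collect q ⟩
    q * 4 * 5           ≤⟨ m≤n+m (q * 4 * 5) (r * 5) ⟩
    r * 5 + q * 4 * 5   ≡⟨ *-distribʳ-+ 5 r (q * 4) ⟨
    (r + q * 4) * 5     ∎
    where
    expand : ∀ q → suc q * 18 ≡ 18 + q * 18
    expand = solve-∀
    collect : ∀ q → q * 2 + q * 18 ≡ q * 4 * 5
    collect = solve-∀

-- n ≤ D + S + 2T with D < n/3 and S ≤ n/9 leaves 2T > 5n/9 ≥ 2K.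
fewDMoves⇒manyTouching : ∀ n D S T K → n ≤ D + S + (T + T) → 3 * D < n → 9 * S ≤ n → K * 18 ≤ n * 5 → K ≤ T
fewDMoves⇒manyTouching n D S T K n≤D+S+2T 3D<n 9S≤n 18K≤5n =
  *-cancelʳ-≤ K T 18 (≤-trans 18K≤5n (≤-trans (m≤m+n (n * 5) 3) (+-cancelˡ-≤ (n * 4) _ _ (begin
    n * 4 + (n * 5 + 3)                  ≡⟨ regroup₁ n ⟩
    n * 9 + 3                            ≤⟨ +-monoˡ-≤ 3 (*-monoˡ-≤ 9 n≤D+S+2T) ⟩
    (D + S + (T + T)) * 9 + 3            ≡⟨ regroup₂ D S T ⟩
    suc (3 * D) * 3 + 9 * S + T * 18     ≤⟨ +-monoˡ-≤ (T * 18) (+-mono-≤ (*-monoˡ-≤ 3 3D<n) 9S≤n) ⟩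
    n * 3 + n + T * 18                   ≡⟨ regroup₃ n T ⟩
    n * 4 + T * 18                       ∎))))
  where
  open ≤-Reasoning
  regroup₁ : ∀ n → n * 4 + (n * 5 + 3) ≡ n * 9 + 3
  regroup₁ = solve-∀
  regroup₂ : ∀ D S T → (D + S + (T + T)) * 9 + 3 ≡ suc (3 * D) * 3 + 9 * S + T * 18
  regroup₂ = solve-∀
  regroup₃ : ∀ n T → n * 3 + n + T * 18 ≡ n * 4 + T * 18
  regroup₃ = solve-∀

length-choiceSeqs-elements : ∀ b₀ d → All (λ cs → length cs ≡ d) (choiceSeqs b₀ d)
length-choiceSeqs-elements b₀ zero    = refl ∷ []
length-choiceSeqs-elements b₀ (suc d) =
  concat⁺ (map⁺ (universal (λ c → map⁺ (All.map (cong suc) (length-choiceSeqs-elements (suc b₀) d))) (upTo b₀)))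

module _ (s : Strategy) {n₀ : ℕ} {β : List ℕ} (cyc : IsCycle n₀ β) where

  private
    α = aliceAt s n₀ β
    inv = initialInvariant s β cyc
    n₀≢0 : NonZero n₀
    n₀≢0 = >-nonZero (≤-trans (s≤s z≤n) (cycle-size≥3 cyc))

  badCount≤atLeastTouching : ∀ K → 9 * commonEdges α β ≤ n₀ → K * 18 ≤ n₀ * 5 →
    badCount s n₀ β ≤ count (atLeastTouching s K β α) (choiceSeqs n₀ n₀)
  badCount≤atLeastTouching K 9S≤n₀ 18K≤5n₀ = count-mono (choiceSeqs n₀ n₀) few⇒many
    where
    few⇒many : ∀ {cs} → cs ∈ choiceSeqs n₀ n₀ → T (3 * dMoves s β α cs <ᵇ n₀) → T (atLeastTouching s K β α cs)
    few⇒many {cs} cs∈ few = ≤⇒≤ᵇ (fewDMoves⇒manyTouching n₀ D (commonEdges α β) Tch K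
      (subst (_≤ D + commonEdges α β + (Tch + Tch)) (All.lookup (length-choiceSeqs-elements n₀ n₀) cs∈)
             (moves≤dMoves+common+2touching s β α cs inv))
      (<ᵇ⇒< _ _ few) 9S≤n₀ 18K≤5n₀)
      where
      D = dMoves s β α cs
      Tch = touchingMoves s β α cs

  atLeastTouching*K!≤4^K*total : ∀ K → count (atLeastTouching s K β α) (choiceSeqs n₀ n₀) * K ! ≤ 4 ^ K * totalCount n₀
  atLeastTouching*K!≤4^K*total K = *-cancelˡ-≤ (n₀ ^ K) {{m^n≢0 n₀ K {{n₀≢0}}}} (begin
    n₀ ^ K * (c * K !)          ≡⟨ *-Semigroup.x∙yz≈y∙xz (n₀ ^ K) c (K !) ⟩
    c * (n₀ ^ K * K !)          ≤⟨ touching-tail s n₀ K β α n₀ (sym (length-cycle cyc)) inv ⟩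
    (4 * n₀) ^ K * total        ≡⟨ cong (_* total) (^-distribʳ-* 4 n₀ K) ⟩
    4 ^ K * n₀ ^ K * total      ≡⟨ *-Semigroup.xy∙z≈y∙xz (4 ^ K) (n₀ ^ K) total ⟩
    n₀ ^ K * (4 ^ K * total)    ∎)
    where
    open ≤-Reasoning
    c = count (atLeastTouching s K β α) (choiceSeqs n₀ n₀)
    total = totalCount n₀

lemma8 : (a b n₀ : ℕ) → 0 < a → a < b → 900 ≤ n₀
    → (∃ λ k → b ^ 8 * k ! ≤ a ^ 8 * expPartial n₀ k)
    → (s : Strategy) (β : List ℕ) → IsCycle n₀ β
    → LnSqBound (commonEdges (aliceAt s n₀ β) β) n₀
    → badCount s n₀ β * b ≤ a * totalCount n₀
lemma8 a b n₀ _ _ 900≤n₀ (k , b⁸k!≤a⁸E) s β cyc lnSq with choose-K n₀ 900≤n₀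
... | K , 2n₀≤8K , 128≤K , 18K≤5n₀ = *-cancelˡ-≤ (K !) {{K !≢0}} (begin
  K ! * (bad * b)          ≡⟨ *-Semigroup.x∙yz≈yx∙z (K !) bad b ⟩
  bad * K ! * b            ≤⟨ *-monoˡ-≤ b (*-monoˡ-≤ (K !) bad≤c) ⟩
  c * K ! * b              ≤⟨ *-monoˡ-≤ b (atLeastTouching*K!≤4^K*total s cyc K) ⟩
  4 ^ K * total * b        ≡⟨ *-Semigroup.xy∙z≈y∙zx (4 ^ K) total b ⟩
  total * (b * 4 ^ K)      ≤⟨ *-monoʳ-≤ total (b*4^K≤a*K! a b k b⁸k!≤a⁸E) ⟩
  total * (a * K !)        ≡⟨ *-Semigroup.x∙yz≈z∙yx total a (K !) ⟩
  K ! * (a * total)        ∎)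
  where
  open ≤-Reasoning
  open ExponentialBound n₀ K 2n₀≤8K 128≤K
  α = aliceAt s n₀ β
  bad = badCount s n₀ β
  c = count (atLeastTouching s K β α) (choiceSeqs n₀ n₀)
  total = totalCount n₀
  bad≤c : bad ≤ c
  bad≤c = badCount≤atLeastTouching s cyc K (lnSq⇒9S≤n (commonEdges α β) n₀ 900≤n₀ lnSq) 18K≤5n₀
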